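{- For $j\in\omega$ let $X_j=\{v_{j,s}: s\in 2^j\}$ be pairwise disjoint sets of new vertices indexed by binary strings of length $j$, and for $n\ge 1$ let $H_n$ be the tournament on $\bigcup_{j<n}X_j$ defined by: for $i<j<n$, $v_{j,s}\to v_{i,t}$ if $s(i)=1$ and $v_{i,t}\to v_{j,s}$ if $s(i)=0$; and within a level, $v_{j,s}\to v_{j,t}$ iff $s<_{\mathrm{lex}}t$. Then $\mathsf{rk}(H_n)=n$ for every $n\ge 1$.
   Context: A tournament is a structure $(T,\to)$ with one binary relation such that for every pair of distinct elements $u,v$ exactly one of $u\to v$, $v\to u$ holds (and no $u\to u$). Substructures are induced; $\mathsf{age}(X)$ is the set of finite subtournaments of $X$. If $A\le B$ and $|B\setminus A|=1$, $B$ is a prime extension of $A$. If $A\le B$, $A\le X$, a realization of $B$ in $X$ is some $C\le X$ with $A\le C$ and an isomorphism $B\to C$ fixing $A$ pointwise. For a countable tournament $X$ and $F\in\mathsf{age}(X)$: $\mathsf{rk}_X(F)\ge 0$ always; $\mathsf{rk}_X(F)\ge\alpha+1$ iff every prime extension of $F$ that is a finite tournament has a realization $C$ in $X$ with $\mathsf{rk}_X(C)\ge\alpha$; for limit $\alpha$, $\mathsf{rk}_X(F)\ge\alpha$ iff $\mathsf{rk}_X(F)\ge\beta$ for all $\beta<\alpha$; $\mathsf{rk}_X(F)=\sup\{\alpha:\mathsf{rk}_X(F)\ge\alpha\}$; $\mathsf{rk}(X)=\mathsf{rk}_X(\emptyset)$. $<_{\mathrm{lex}}$ is the lexicographic order on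 binary strings of equal length. -}

module Defs where

open import Data.Nat using (ℕ; zero; suc; _<_)
open import Data.Bool using (Bool; true; false)
open import Data.List using (List; []; _∷_; length)
open import Data.List.Membership.Propositional using (_∈_; _∉_)
open import Data.Maybe using (Maybe; just; nothing)
open import Data.Product using (Σ; ∃; _×_; _,_; proj₁)
open import Data.Unit using (⊤)
open import Relation.Binary.PropositionalEquality using (_≡_)
open import Function.Bundles using (_⇔_)

-- A prime extension of F (a one-point tournament extension) is, up to
-- isomorphism over F, given by the orientation between the new point and
-- each f ∈ F, i.e. a map p : V → Bool (only its values on F matter):
-- p f ≡ true means "new point → f", false means "f → new point".

module Rank (V : Set) (_⇒_ : V → V → Set) where

  Realizes : List V → (V → Bool) → V → Set
  Realizes F p x = (x ∉ F) × (∀ f → f ∈ F → (x ⇒ f) ⇔ (p f ≡ true))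

  rk≥ : ℕ → List V → Set
  rk≥ zero    F = ⊤
  rk≥ (suc k) F = (p : V → Bool) → Σ V λ x → Realizes F p x × rk≥ k (x ∷ F)

-- The tournament H_n.  Vertex v_{j,s} (s ∈ 2^j, j < n) is represented by
-- the binary string s itself (its level j is length s).

bit : List Bool → ℕ → Maybe Bool
bit []      _       = nothing
bit (b ∷ s) zero    = just b
bit (b ∷ s) (suc i) = bit s i

-- strict lexicographic order (used only on strings of equal length)
data _<lex_ : List Bool → List Bool → Set where
  here : ∀ {s t} → (false ∷ s) <lex (true ∷ t)
  there : ∀ {b s t} → s <lex t → (b ∷ s) <lex (b ∷ t)

data _⟶_ (s t : List Bool) : Set where
  down : length t < length s → bit s (length t) ≡ just true → s ⟶ t
  up   : length s < length t → bit t (length s) ≡ just false → s ⟶ t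
  lvl  : length s ≡ length t → s <lex t → s ⟶ t

HV : ℕ → Set
HV n = Σ (List Bool) λ s → length s < n

_⇒H_ : ∀ {n} → HV n → HV n → Set
u ⇒H v = proj₁ u ⟶ proj₁ v

rkH≥ : ℕ → ℕ → Set
rkH≥ n k = Rank.rk≥ (HV n) (_⇒H_ {n}) k []

-- Upper bound: if rk(X) ≥ k+1, choosing realizations k times produces k distinct vertices G over
-- which every one of the 2^k orientation patterns is realized, and distinct patterns need distinct
-- realizers; so 2^k ≤ |X|, and |H_n| = 2^n − 1 forces k < n.
-- Lower bound: a vertex on level j sees every lower level only through its own bits, so if F
-- contains exactly one vertex on each level below j, any orientation pattern over F is realized by
-- the string of level j whose i-th bit is the prescribed orientation towards F's vertex on level i.
module Submission where

open import Defs
open import Data.Nat using (ℕ; zero; suc; _+_; _*_; _^_; _≤_; _<_; _<?_; z≤n; s≤s)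
open import Data.Nat.Properties
  using (<-irrelevant; <-irrefl; <-asym; +-suc; +-comm; +-identityʳ; *-suc; ≤-trans; ≤-reflexive;
         m≤n+m; m<n⇒m<1+n; <-≤-trans; ≮⇒≥; <⇒≱; ^-monoʳ-≤)
open import Data.Bool using (Bool; true; false; if_then_else_)
open import Data.Bool.Properties using (⇔→≡)
open import Data.Fin using (Fin; zero; suc; combine; remQuot; quotient; remainder)
open import Data.Fin.Properties
  using (2↔Bool; combine-remQuot; combine-injective; suc-injective; inj⇒≟; injective⇒≤)
open import Data.List using (List; []; _∷_; length; _∷ʳ_)
open import Data.List.Properties using (length-++)
open import Data.List.Membership.Propositional using (_∈_; _∉_)
open import Data.List.Relation.Unary.Any using (here; there)
import Data.List.Relation.Unary.All as All
open import Data.List.Relation.Unary.All.Properties using (¬Any⇒All¬)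
open import Data.List.Relation.Unary.Unique.Propositional using (Unique; []; _∷_)
open import Data.Maybe using (just)
open import Data.Maybe.Properties using (just-injective)
open import Data.Product using (Σ; _×_; _,_; proj₁; proj₂; uncurry)
open import Data.Unit using (tt)
open import Relation.Nullary using (does; yes; no; contradiction)
open import Relation.Nullary.Decidable using (dec-true; dec-false)
open import Relation.Binary.PropositionalEquality
open import Function using (_∘_)
open import Function.Bundles using (_⇔_; Inverse; Injection; _↣_; mk↣; mk⇔)
open import Function.Properties.Inverse using (↔-sym; ↔⇒↣)
open import Function.Construct.Symmetry using (⇔-sym)
open import Function.Construct.Composition using (_⇔-∘_)

bit₂ : Fin 2 → Bool
bit₂ = Inverse.to 2↔Bool

bit₂-injective : ∀ {a b} → bit₂ a ≡ bit₂ b → a ≡ b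
bit₂-injective = Injection.injective (↔⇒↣ 2↔Bool)

fin₂ : Bool → Fin 2
fin₂ = Inverse.from 2↔Bool

fin₂-injective : ∀ {a b} → fin₂ a ≡ fin₂ b → a ≡ b
fin₂-injective = Injection.injective (↔⇒↣ (↔-sym 2↔Bool))

remQuot-injective : ∀ {m} n {i j : Fin (m * n)} → remQuot {m} n i ≡ remQuot n j → i ≡ j
remQuot-injective {m} n {i} {j} eq =
  trans (sym (combine-remQuot {m} n i)) (trans (cong (uncurry combine) eq) (combine-remQuot {m} n j))

module RankBounds (V : Set) (_⇒_ : V → V → Set) where
  open Rank V _⇒_

  AllPatternsRealized : List V → Set
  AllPatternsRealized G = (p : V → Bool) → Σ V (Realizes G p)

  realizers-agree : ∀ {F p q x f} → Realizes F p x → Realizes F q x → f ∈ F → p f ≡ q f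
  realizers-agree {f = f} (_ , xp) (_ , xq) f∈F = ⇔→≡ (xq f f∈F ⇔-∘ ⇔-sym (xp f f∈F))

  rk≥-suc⇒allPatternsRealized : ∀ k {F} → Unique F → rk≥ (suc k) F →
    Σ (List V) λ G → Unique G × length G ≡ k + length F × AllPatternsRealized G
  rk≥-suc⇒allPatternsRealized zero {F} uF r =
    F , uF , refl , λ p → proj₁ (r p) , proj₁ (proj₂ (r p))
  rk≥-suc⇒allPatternsRealized (suc k) {F} uF r
    with x , (x∉F , _) , r′ ← r (λ _ → true)
    with G , uG , |G| , allG ← rk≥-suc⇒allPatternsRealized k (¬Any⇒All¬ F x∉F ∷ uF) r′
    = G , uG , trans |G| (+-suc k (length F)) , allG

  module Counting {N : ℕ} (ι : V ↣ Fin N) where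
    open Injection ι using (injective)
    private _≟_ = inj⇒≟ ι

    -- The i-th pattern over G reads the binary digits of i, one per element of G.
    digitPattern : (G : List V) → Fin (2 ^ length G) → V → Bool
    digitPattern []      _ _ = false
    digitPattern (g ∷ G) i v =
      if does (v ≟ g) then bit₂ (quotient {2} (2 ^ length G) i)
                      else digitPattern G (remainder {2} (2 ^ length G) i) v

    digitPattern-injective : ∀ {G} → Unique G → ∀ {i j} →
                             (∀ {f} → f ∈ G → digitPattern G i f ≡ digitPattern G j f) → i ≡ j
    digitPattern-injective {[]}    []          {zero} {zero} _     = refl
    digitPattern-injective {g ∷ G} (g∉G ∷ uG) {i} {j} agree =
      remQuot-injective {2} (2 ^ length G)
        (cong₂ _,_ (bit₂-injective on-g) (digitPattern-injective uG on-G))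
      where
      on-g : bit₂ (quotient {2} (2 ^ length G) i) ≡ bit₂ (quotient {2} (2 ^ length G) j)
      on-g with agree (here refl)
      ... | eq rewrite dec-true (g ≟ g) refl = eq
      on-G : ∀ {f} → f ∈ G → digitPattern G (remainder {2} _ i) f ≡ digitPattern G (remainder {2} _ j) f
      on-G {f} f∈G with agree (there f∈G)
      ... | eq rewrite dec-false (f ≟ g) (All.lookup g∉G f∈G ∘ sym) = eq

    allPatternsRealized⇒2^≤ : ∀ {G} → Unique G → AllPatternsRealized G → 2 ^ length G ≤ N
    allPatternsRealized⇒2^≤ {G} uG real = injective⇒≤ realizer-injective
      where
      realizer : Fin (2 ^ length G) → Fin N
      realizer i = Injection.to ι (proj₁ (real (digitPattern G i)))
      realizer-injective : ∀ {i j} → realizer i ≡ realizer j → i ≡ j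
      realizer-injective {i} {j} eq = digitPattern-injective uG
        (realizers-agree (proj₂ (real (digitPattern G i)))
                         (subst (Realizes G _) (sym (injective eq)) (proj₂ (real (digitPattern G j)))))

    rk≥-suc⇒2^≤ : ∀ k → rk≥ (suc k) [] → 2 ^ k ≤ N
    rk≥-suc⇒2^≤ k r with G , uG , |G| , real ← rk≥-suc⇒allPatternsRealized k [] r =
      subst (λ m → 2 ^ m ≤ N) (trans |G| (+-identityʳ k)) (allPatternsRealized⇒2^≤ uG real)

stringsBelow : ℕ → ℕ
stringsBelow zero    = 0
stringsBelow (suc n) = suc (2 * stringsBelow n)

stringsBelow<2^ : ∀ n → stringsBelow n < 2 ^ n
stringsBelow<2^ n = ≤-reflexive (suc-stringsBelow n)
  where
  suc-stringsBelow : ∀ n → suc (stringsBelow n) ≡ 2 ^ n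
  suc-stringsBelow zero    = refl
  suc-stringsBelow (suc n) = begin
    suc (suc (2 * stringsBelow n))  ≡⟨ *-suc 2 (stringsBelow n) ⟨
    2 * suc (stringsBelow n)        ≡⟨ cong (2 *_) (suc-stringsBelow n) ⟩
    2 * 2 ^ n                       ∎
    where open ≡-Reasoning

encode : ∀ {n} (s : List Bool) → length s < n → Fin (stringsBelow n)
encode {suc n} []      _       = zero
encode {suc n} (b ∷ s) (s≤s l) = suc (combine (fin₂ b) (encode s l))

encode-injective : ∀ {n} s t (ls : length s < n) (lt : length t < n) →
                   encode s ls ≡ encode t lt → s ≡ t
encode-injective {suc n} []      []      _        _        _  = refl
encode-injective {suc n} []      (c ∷ t) _        (s≤s _)  ()
encode-injective {suc n} (b ∷ s) []      (s≤s _)  _        ()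
encode-injective {suc n} (b ∷ s) (c ∷ t) (s≤s ls) (s≤s lt) eq
  with b≡c , es≡et ← combine-injective _ _ _ _ (suc-injective eq) =
  cong₂ _∷_ (fin₂-injective b≡c) (encode-injective s t ls lt es≡et)

H↣Fin : ∀ n → HV n ↣ Fin (stringsBelow n)
H↣Fin n = mk↣ λ {(s , ls)} {(t , lt)} eq → injective s t ls lt eq
  where
  injective : ∀ s t ls lt → encode s ls ≡ encode t lt → (s , ls) ≡ (t , lt)
  injective s t ls lt eq with refl ← encode-injective s t ls lt eq = cong (s ,_) (<-irrelevant ls lt)

rkH≥⇒≤ : ∀ {n} k → rkH≥ n k → k ≤ n
rkH≥⇒≤     zero    _ = z≤n
rkH≥⇒≤ {n} (suc k) r with k <? n
... | yes k<n = k<n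
... | no  k≮n = contradiction (^-monoʳ-≤ 2 (≮⇒≥ k≮n)) (<⇒≱ 2^k<2^n)
  where
  open RankBounds (HV n) _⇒H_
  2^k<2^n : 2 ^ k < 2 ^ n
  2^k<2^n = <-≤-trans (s≤s (Counting.rk≥-suc⇒2^≤ (H↣Fin n) k r)) (stringsBelow<2^ n)

bit-∷ʳ-< : ∀ s b {i} → i < length s → bit (s ∷ʳ b) i ≡ bit s i
bit-∷ʳ-< (_ ∷ s) b {zero}  _       = refl
bit-∷ʳ-< (_ ∷ s) b {suc i} (s≤s l) = bit-∷ʳ-< s b l

bit-∷ʳ-length : ∀ s b → bit (s ∷ʳ b) (length s) ≡ just b
bit-∷ʳ-length []      b = refl
bit-∷ʳ-length (_ ∷ s) b = bit-∷ʳ-length s b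

module _ {n : ℕ} where
  open Rank (HV n) _⇒H_

  -- Newest vertex first, as in rk≥: a ladder w_{m−1} ∷ … ∷ w_0 has w_i on level i.
  data Ladder : List (HV n) → Set where
    []  : Ladder []
    _∷_ : ∀ {w F} → length (proj₁ w) ≡ length F → Ladder F → Ladder (w ∷ F)

  level<length : ∀ {F f} → Ladder F → f ∈ F → length (proj₁ f) < length F
  level<length (e ∷ _) (here refl) = s≤s (≤-reflexive e)
  level<length (_ ∷ l) (there f∈F) = m<n⇒m<1+n (level<length l f∈F)

  profile : (HV n → Bool) → List (HV n) → List Bool
  profile p []      = []
  profile p (w ∷ F) = profile p F ∷ʳ p w

  length-profile : ∀ p F → length (profile p F) ≡ length F
  length-profile p []      = refl
  length-profile p (w ∷ F) =
    trans (length-++ (profile p F)) (trans (+-comm _ 1) (cong suc (length-profile p F)))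

  bit-profile : ∀ p {F f} → Ladder F → f ∈ F → bit (profile p F) (length (proj₁ f)) ≡ just (p f)
  bit-profile p {w ∷ F} (e ∷ _) (here refl) =
    trans (cong (bit (profile p F ∷ʳ p w)) (trans e (sym (length-profile p F))))
          (bit-∷ʳ-length (profile p F) (p w))
  bit-profile p {w ∷ F} (_ ∷ l) (there f∈F) =
    trans (bit-∷ʳ-< (profile p F) (p w) (subst (_ <_) (sym (length-profile p F)) (level<length l f∈F)))
          (bit-profile p l f∈F)

  ladder-rk≥ : ∀ k {F} → Ladder F → k + length F ≤ n → rk≥ k F
  ladder-rk≥ zero    _ _ = tt
  ladder-rk≥ (suc k) {F} l k+|F|<n p =
    x , (x∉F , orientation) ,
    ladder-rk≥ k (length-profile p F ∷ l) (subst (_≤ n) (sym (+-suc k _)) k+|F|<n)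
    where
    x : HV n
    x = profile p F , ≤-trans (s≤s (≤-trans (≤-reflexive (length-profile p F)) (m≤n+m _ k))) k+|F|<n
    x∉F : x ∉ F
    x∉F x∈F = <-irrefl (length-profile p F) (level<length l x∈F)
    orientation : ∀ f → f ∈ F → (x ⇒H f) ⇔ (p f ≡ true)
    orientation f f∈F = mk⇔ to from
      where
      below : length (proj₁ f) < length (profile p F)
      below = subst (_ <_) (sym (length-profile p F)) (level<length l f∈F)
      to : x ⇒H f → p f ≡ true
      to (down _ b≡1) = just-injective (trans (sym (bit-profile p l f∈F)) b≡1)
      to (up above _) = contradiction below (<-asym above)
      to (lvl same _) = contradiction below (<-irrefl (sym same))
      from : p f ≡ true → x ⇒H f
      from pf = down below (trans (bit-profile p l f∈F) (cong just pf))

theorem5p3 : ∀ (n : ℕ) → 1 ≤ n → ∀ (k : ℕ) → rkH≥ n k ⇔ (k ≤ n)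
theorem5p3 n _ k =
  mk⇔ (rkH≥⇒≤ k) (λ k≤n → ladder-rk≥ k [] (subst (_≤ n) (sym (+-identityʳ k)) k≤n))
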